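{- Let $\mathsf{X} = \langle \mathsf{E}, \mathsf{po}, \mathsf{rf}, \mathsf{mo}\rangle$ be a 1-Writer execution graph. Then for $\mathcal{M} \in \{\mathsf{SRA}, \mathsf{RA}\}$, $\mathsf{X}$ is consistent with $\mathcal{M}$ if and only if $\mathsf{mo}$ agrees with $\mathsf{po}$ and $\mathsf{X}$ is consistent with $\mathsf{WRA}$.
   Context: An event is a memory operation, either a read $\mathtt{r}(x,v)$ or a write $\mathtt{w}(x,v)$, where $x$ is a shared variable and $v$ a value; events are distributed over threads. An execution graph is a tuple $\mathsf{X}=\langle \mathsf{E},\mathsf{po},\mathsf{rf},\mathsf{mo}\rangle$ where $\mathsf{E}$ is a finite set of events; the program order $\mathsf{po}$ is a strict partial order that totally orders the events of each thread; the reads-from relation $\mathsf{rf}\subseteq \mathsf{W}\times\mathsf{R}$ relates writes to reads on the same variable with the same value, with every read related to exactly one write; the modification order $\mathsf{mo}=\bigcup_x \mathsf{mo}_x$ where each $\mathsf{mo}_x$ is a strict total order on the writes to $x$. Happens-before is $\mathsf{hb}=(\mathsf{po}\cup\mathsf{rf})^+$. Axioms: porf-acyclicity: $\mathsf{po}\cup\mathsf{rf}$ is acyclic. Write-coherence: no writes $w,w'$ on the same variable with $w\,\mathsf{mo}\,w'$ and $w'\,\mathsf{hb}\,w$. Strong-write-coherence: $\mathsf{hb}\cup\mathsf{mo}$ is acyclic. Read-coherence: no read $r$ on $x$ and writes $w,w'$ on $x$ with $w\,\mathsf{rf}\,r$, $w\,\mathsf{mo}_x\,w'$, $w'\,\mathsf{hb}\,r$.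 Weak-read-coherence: no read $r$ on $x$ and writes $w,w'$ on $x$ with $w\,\mathsf{rf}\,r$, $w\,\mathsf{hb}\,w'$, $w'\,\mathsf{hb}\,r$. Consistency with $\mathsf{WRA}$: porf-acyclicity and weak-read-coherence; with $\mathsf{RA}$: porf-acyclicity, write-coherence, read-coherence; with $\mathsf{SRA}$: porf-acyclicity, strong-write-coherence, read-coherence. An execution graph is 1-Writer if for every variable, all write events on that variable belong to a single thread (any number of threads may read it). In this case, "$\mathsf{mo}$ agrees with $\mathsf{po}$" means: for all writes $w_1,w_2$ on the same variable, $w_1\,\mathsf{mo}\,w_2$ iff $w_1\,\mathsf{po}\,w_2$. -}

module Defs where

open import Data.Nat using (ℕ)
open import Data.Fin using (Fin)
open import Data.Product using (_×_; Σ; ∃)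
open import Data.Sum using (_⊎_)
open import Relation.Nullary using (¬_)
open import Relation.Binary.PropositionalEquality using (_≡_)
open import Relation.Binary.Construct.Closure.Transitive using (TransClosure)

Thread : Set
Thread = ℕ

Var : Set
Var = ℕ

Val : Set
Val = ℕ

data Kind : Set where
  rd wr : Kind

record Label : Set where
  constructor lab
  field
    kind : Kind
    tid  : Thread
    loc  : Var
    val  : Val

Rel : Set → Set₁
Rel A = A → A → Set

_∪_ : {A : Set} → Rel A → Rel A → Rel A
(R ∪ S) a b = R a b ⊎ S a b

IsStrictPO : {A : Set} → Rel A → Set
IsStrictPO R = (∀ a → ¬ R a a) × (∀ a b c → R a b → R b c → R a c)

Acyclic : {A : Set} → Rel A → Set
Acyclic R = ∀ a → ¬ TransClosure R a a

record ExecGraph : Set₁ where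
  field
    size : ℕ
    ℓ    : Fin size → Label
    po   : Rel (Fin size)
    rf   : Rel (Fin size)
    mo   : Rel (Fin size)

  Ev : Set
  Ev = Fin size

  IsRead : Ev → Set
  IsRead e = Label.kind (ℓ e) ≡ rd

  IsWrite : Ev → Set
  IsWrite e = Label.kind (ℓ e) ≡ wr

  loc : Ev → Var
  loc e = Label.loc (ℓ e)

  val : Ev → Val
  val e = Label.val (ℓ e)

  tid : Ev → Thread
  tid e = Label.tid (ℓ e)

  hb : Rel Ev
  hb = TransClosure (po ∪ rf)

record WellFormed (X : ExecGraph) : Set where
  open ExecGraph X
  field
    po-spo     : IsStrictPO po
    po-thread  : ∀ a b → po a b → tid a ≡ tid b
    po-total   : ∀ a b → tid a ≡ tid b → ¬ a ≡ b → po a b ⊎ po b a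
    rf-wr      : ∀ w r → rf w r → IsWrite w × IsRead r
    rf-loc     : ∀ w r → rf w r → loc w ≡ loc r
    rf-val     : ∀ w r → rf w r → val w ≡ val r
    rf-exists  : ∀ r → IsRead r → ∃ λ w → rf w r
    rf-unique  : ∀ w w' r → rf w r → rf w' r → w ≡ w'
    -- mo = ⋃_x mo_x, each mo_x a strict total order on writes to x
    mo-w       : ∀ w w' → mo w w' → IsWrite w × IsWrite w'
    mo-loc     : ∀ w w' → mo w w' → loc w ≡ loc w'
    mo-spo     : IsStrictPO mo
    mo-total   : ∀ w w' → IsWrite w → IsWrite w' → loc w ≡ loc w' → ¬ w ≡ w' →
                 mo w w' ⊎ mo w' w

module _ (X : ExecGraph) where
  open ExecGraph X

  PorfAcyclic : Set
  PorfAcyclic = Acyclic (po ∪ rf)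

  WriteCoherence : Set
  WriteCoherence = ∀ w w' → IsWrite w → IsWrite w' → loc w ≡ loc w' →
                   ¬ (mo w w' × hb w' w)

  StrongWriteCoherence : Set
  StrongWriteCoherence = Acyclic (hb ∪ mo)

  ReadCoherence : Set
  ReadCoherence = ∀ r w w' → IsRead r → IsWrite w → IsWrite w' →
                  loc r ≡ loc w → loc r ≡ loc w' →
                  ¬ (rf w r × mo w w' × hb w' r)

  WeakReadCoherence : Set
  WeakReadCoherence = ∀ r w w' → IsRead r → IsWrite w → IsWrite w' →
                      loc r ≡ loc w → loc r ≡ loc w' →
                      ¬ (rf w r × hb w w' × hb w' r)

  OneWriter : Set
  OneWriter = ∀ w w' → IsWrite w → IsWrite w' → loc w ≡ loc w' → tid w ≡ tid w'

  MoAgreesPo : Set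
  MoAgreesPo = ∀ w w' → IsWrite w → IsWrite w' → loc w ≡ loc w' →
               (mo w w' → po w w') × (po w w' → mo w w')

data Model : Set where
  WRA RA SRA : Model

Consistent : Model → ExecGraph → Set
Consistent WRA X = PorfAcyclic X × WeakReadCoherence X
Consistent RA  X = PorfAcyclic X × WriteCoherence X × ReadCoherence X
Consistent SRA X = PorfAcyclic X × StrongWriteCoherence X × ReadCoherence X

{-# OPTIONS --safe #-}
-- With a single writer per variable, po totally orders the writes to each
-- variable, so write coherence forces mo to coincide with po there. Then
-- mo ⊆ hb: every (hb ∪ mo)-cycle collapses to an hb-cycle, and read coherence
-- (stated with mo) becomes weak read coherence (stated with hb). Conversely,
-- an mo-edge between distinct writes that fails weak read coherence either
-- contradicts read coherence or closes an mo/hb cycle.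
module Submission where

open import Defs
open import Data.Product using (_×_; _,_; proj₁)
open import Data.Sum using (_⊎_; inj₁; inj₂)
open import Data.Empty using (⊥-elim)
open import Data.Fin using (_≟_)
open import Relation.Nullary using (yes; no)
open import Relation.Binary.PropositionalEquality using (_≡_; refl; sym; trans)
open import Relation.Binary.Construct.Closure.Transitive using (TransClosure; [_]; _∷_; _++_)
open import Function.Bundles using (_⇔_; mk⇔)

⁺-minimal : {A : Set} {R S : Rel A} →
            (∀ {a b} → R a b → S a b) →
            (∀ {a b c} → S a b → S b c → S a c) →
            ∀ {a b} → TransClosure R a b → S a b
⁺-minimal R⊆S S-trans [ r ]    = R⊆S r
⁺-minimal R⊆S S-trans (r ∷ rs) = S-trans (R⊆S r) (⁺-minimal R⊆S S-trans rs)

strongWriteCoherence⇒writeCoherence : (X : ExecGraph) →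
  StrongWriteCoherence X → WriteCoherence X
strongWriteCoherence⇒writeCoherence X swc w w' _ _ _ (mo-ww' , hb-w'w) =
  swc w (inj₂ mo-ww' ∷ [ inj₁ hb-w'w ])

sra⇒ra : (X : ExecGraph) → Consistent SRA X → Consistent RA X
sra⇒ra X (pa , swc , rc) = pa , strongWriteCoherence⇒writeCoherence X swc , rc

module _ {X : ExecGraph} (wf : WellFormed X) where
  open ExecGraph X
  open WellFormed wf

  writeCoherence⇒moAgreesPo : OneWriter X → WriteCoherence X → MoAgreesPo X
  writeCoherence⇒moAgreesPo ow wc w w' iw iw' same-loc = mo⇒po , po⇒mo
    where
    mo⇒po : mo w w' → po w w'
    mo⇒po m with po-total w w' (ow w w' iw iw' same-loc) (λ { refl → proj₁ mo-spo w m })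
    ... | inj₁ p = p
    ... | inj₂ p = ⊥-elim (wc w w' iw iw' same-loc (m , [ inj₁ p ]))

    po⇒mo : po w w' → mo w w'
    po⇒mo p with mo-total w w' iw iw' same-loc (λ { refl → proj₁ po-spo w p })
    ... | inj₁ m = m
    ... | inj₂ m = ⊥-elim (wc w' w iw' iw (sym same-loc) (m , [ inj₁ p ]))

  ra⇒weakReadCoherence : Consistent RA X → WeakReadCoherence X
  ra⇒weakReadCoherence (pa , wc , rc) r w w' ir iw iw' loc-w loc-w' (rf-wr , hb-ww' , hb-w'r)
    with w ≟ w'
  ... | yes refl = pa w hb-ww'
  ... | no w≢w' with mo-total w w' iw iw' (trans (sym loc-w) loc-w') w≢w'
  ...   | inj₁ mo-ww' = rc r w w' ir iw iw' loc-w loc-w' (rf-wr , mo-ww' , hb-w'r)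
  ...   | inj₂ mo-w'w = wc w' w iw' iw (trans (sym loc-w') loc-w) (mo-w'w , hb-ww')

  mo⊆hb : MoAgreesPo X → ∀ {w w'} → mo w w' → hb w w'
  mo⊆hb agree {w} {w'} m with mo-w w w' m
  ... | iw , iw' = [ inj₁ (proj₁ (agree w w' iw iw' (mo-loc w w' m)) m) ]

  moAgreesPo⇒strongWriteCoherence : MoAgreesPo X → PorfAcyclic X → StrongWriteCoherence X
  moAgreesPo⇒strongWriteCoherence agree pa a cycle = pa a (⁺-minimal hb∪mo⊆hb _++_ cycle)
    where
    hb∪mo⊆hb : ∀ {a b} → (hb ∪ mo) a b → hb a b
    hb∪mo⊆hb (inj₁ h) = h
    hb∪mo⊆hb (inj₂ m) = mo⊆hb agree m

  moAgreesPo⇒readCoherence : MoAgreesPo X → WeakReadCoherence X → ReadCoherence X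
  moAgreesPo⇒readCoherence agree wrc r w w' ir iw iw' loc-w loc-w' (rf-wr , mo-ww' , hb-w'r) =
    wrc r w w' ir iw iw' loc-w loc-w' (rf-wr , mo⊆hb agree mo-ww' , hb-w'r)

  ra⇒moAgreesPo×wra : OneWriter X → Consistent RA X → MoAgreesPo X × Consistent WRA X
  ra⇒moAgreesPo×wra ow ra@(pa , wc , _) =
    writeCoherence⇒moAgreesPo ow wc , pa , ra⇒weakReadCoherence ra

  moAgreesPo×wra⇒sra : MoAgreesPo X × Consistent WRA X → Consistent SRA X
  moAgreesPo×wra⇒sra (agree , pa , wrc) =
    pa , moAgreesPo⇒strongWriteCoherence agree pa , moAgreesPo⇒readCoherence agree wrc

lemma2 : (X : ExecGraph) → WellFormed X → OneWriter X →
    (M : Model) → M ≡ SRA ⊎ M ≡ RA →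
    Consistent M X ⇔ (MoAgreesPo X × Consistent WRA X)
lemma2 X wf ow .SRA (inj₁ refl) =
  mk⇔ (λ sra → ra⇒moAgreesPo×wra wf ow (sra⇒ra X sra)) (moAgreesPo×wra⇒sra wf)
lemma2 X wf ow .RA (inj₂ refl) =
  mk⇔ (ra⇒moAgreesPo×wra wf ow) (λ c → sra⇒ra X (moAgreesPo×wra⇒sra wf c))
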